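{- Let $k$ be a positive integer. If $G$ is a graph of order $n$ with maximum degree $\Delta(G)$, then $L_{k,t}(G)\leq n+k-\Delta(G)$.
   Context: All graphs are finite and simple. $N(v)$ denotes the open neighborhood of $v$. A set $B\subseteq V(G)$ is a $k$-total limited packing set if $|B\cap N(v)|\leq k$ for every $v\in V(G)$; $L_{k,t}(G)$ is the maximum cardinality of such a set. -}

module Defs where

open import Data.Nat using (ℕ; zero; suc; _≤_; _⊔_)
open import Data.Bool using (Bool; true; false; if_then_else_)
open import Data.Fin using (Fin)
open import Data.Fin.Subset using (Subset; _∩_; ∣_∣)
open import Data.Vec using (Vec; []; _∷_; tabulate)
open import Data.List using (List; []; _∷_; map; _++_; foldr; allFin)
open import Relation.Binary.PropositionalEquality using (_≡_)
open import Relation.Nullary using (Dec; does)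
open import Data.Fin.Properties using (all?)
open import Data.Nat.Properties using (_≤?_)

record Graph (n : ℕ) : Set where
  field
    adj     : Fin n → Fin n → Bool
    sym     : ∀ u v → adj u v ≡ adj v u
    irrefl  : ∀ v → adj v v ≡ false

open Graph public

N : ∀ {n} → Graph n → Fin n → Subset n
N G v = tabulate (λ u → adj G v u)

deg : ∀ {n} → Graph n → Fin n → ℕ
deg G v = ∣ N G v ∣

-- maximum degree Δ(G) (0 for the empty graph)
Δ : ∀ {n} → Graph n → ℕ
Δ {n} G = foldr _⊔_ 0 (map (deg G) (allFin n))

IsKTotalLimitedPacking : ∀ {n} → ℕ → Graph n → Subset n → Set
IsKTotalLimitedPacking k G B = ∀ v → ∣ B ∩ N G v ∣ ≤ k

isKTLP? : ∀ {n} (k : ℕ) (G : Graph n) (B : Subset n) → Dec (IsKTotalLimitedPacking k G B)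
isKTLP? k G B = all? (λ v → ∣ B ∩ N G v ∣ ≤? k)

allSubsets : (n : ℕ) → List (Subset n)
allSubsets zero = [] ∷ []
allSubsets (suc n) = map (true ∷_) (allSubsets n) ++ map (false ∷_) (allSubsets n)

L : ∀ {n} → ℕ → Graph n → ℕ
L {n} k G = foldr _⊔_ 0 (map (λ B → if does (isKTLP? k G B) then ∣ B ∣ else 0) (allSubsets n))

{-# OPTIONS --safe #-}
-- For a k-total limited packing B and any vertex v, inclusion–exclusion gives
-- |B| + deg v = |B ∪ N(v)| + |B ∩ N(v)| ≤ n + k; taking v of maximum degree
-- yields |B| + Δ(G) ≤ n + k.
module Submission where

open import Defs
open import Data.Nat using (ℕ; suc; _+_; _∸_; _≤_; _⊔_; z≤n)
open import Data.Nat.Properties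
  using (+-suc; +-comm; +-monoˡ-≤; +-monoʳ-≤; ⊔-lub; m≤n⇒m≤n+o; m+n≤o⇒m≤o∸n; m≤o∸n⇒m+n≤o; module ≤-Reasoning)
open import Data.Bool using (true; false; if_then_else_)
open import Data.Fin.Subset using (Subset; _∩_; _∪_; ∣_∣)
open import Data.Fin.Subset.Properties using (∣p∣≤n)
open import Data.Vec using ([]; _∷_)
open import Data.List using (List; []; _∷_; map; foldr; allFin)
open import Relation.Nullary using (Dec; does; yes; no)
open import Relation.Binary.PropositionalEquality using (_≡_; refl; cong) renaming (sym to ≡-sym)

∣p∪q∣+∣p∩q∣≡∣p∣+∣q∣ : ∀ {n} (p q : Subset n) → ∣ p ∪ q ∣ + ∣ p ∩ q ∣ ≡ ∣ p ∣ + ∣ q ∣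
∣p∪q∣+∣p∩q∣≡∣p∣+∣q∣ []          []          = refl
∣p∪q∣+∣p∩q∣≡∣p∣+∣q∣ (true  ∷ p) (true  ∷ q)
  rewrite +-suc ∣ p ∪ q ∣ ∣ p ∩ q ∣ | +-suc ∣ p ∣ ∣ q ∣ = cong (λ m → suc (suc m)) (∣p∪q∣+∣p∩q∣≡∣p∣+∣q∣ p q)
∣p∪q∣+∣p∩q∣≡∣p∣+∣q∣ (true  ∷ p) (false ∷ q) = cong suc (∣p∪q∣+∣p∩q∣≡∣p∣+∣q∣ p q)
∣p∪q∣+∣p∩q∣≡∣p∣+∣q∣ (false ∷ p) (true  ∷ q)
  rewrite +-suc ∣ p ∣ ∣ q ∣ = cong suc (∣p∪q∣+∣p∩q∣≡∣p∣+∣q∣ p q)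
∣p∪q∣+∣p∩q∣≡∣p∣+∣q∣ (false ∷ p) (false ∷ q) = ∣p∪q∣+∣p∩q∣≡∣p∣+∣q∣ p q

∣p∣+∣q∣≤n+∣p∩q∣ : ∀ {n} (p q : Subset n) → ∣ p ∣ + ∣ q ∣ ≤ n + ∣ p ∩ q ∣
∣p∣+∣q∣≤n+∣p∩q∣ {n} p q = begin
  ∣ p ∣ + ∣ q ∣          ≡⟨ ≡-sym (∣p∪q∣+∣p∩q∣≡∣p∣+∣q∣ p q) ⟩
  ∣ p ∪ q ∣ + ∣ p ∩ q ∣  ≤⟨ +-monoˡ-≤ ∣ p ∩ q ∣ (∣p∣≤n (p ∪ q)) ⟩
  n + ∣ p ∩ q ∣          ∎
  where open ≤-Reasoning

foldr-⊔-map-lub : ∀ {A : Set} (f : A → ℕ) {m : ℕ} → (∀ a → f a ≤ m) →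
                  (xs : List A) → foldr _⊔_ 0 (map f xs) ≤ m
foldr-⊔-map-lub f f≤m []       = z≤n
foldr-⊔-map-lub f f≤m (x ∷ xs) = ⊔-lub (f≤m x) (foldr-⊔-map-lub f f≤m xs)

if-does-≤ : ∀ {P : Set} (d : Dec P) {x m : ℕ} → (P → x ≤ m) → (if does d then x else 0) ≤ m
if-does-≤ (yes p) x≤m = x≤m p
if-does-≤ (no _)  _   = z≤n

Δ-lub : ∀ {n} (G : Graph n) {m : ℕ} → (∀ v → deg G v ≤ m) → Δ G ≤ m
Δ-lub {n} G deg≤m = foldr-⊔-map-lub (deg G) deg≤m (allFin n)

module _ {n : ℕ} (k : ℕ) (G : Graph n) (B : Subset n) (packing : IsKTotalLimitedPacking k G B) where

  packing-deg+∣B∣≤n+k : ∀ v → deg G v + ∣ B ∣ ≤ n + k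
  packing-deg+∣B∣≤n+k v = begin
    deg G v + ∣ B ∣      ≡⟨ +-comm (deg G v) ∣ B ∣ ⟩
    ∣ B ∣ + ∣ N G v ∣    ≤⟨ ∣p∣+∣q∣≤n+∣p∩q∣ B (N G v) ⟩
    n + ∣ B ∩ N G v ∣    ≤⟨ +-monoʳ-≤ n (packing v) ⟩
    n + k                ∎
    where open ≤-Reasoning

  packing-∣B∣≤n+k∸Δ : ∣ B ∣ ≤ (n + k) ∸ Δ G
  packing-∣B∣≤n+k∸Δ = m+n≤o⇒m≤o∸n ∣ B ∣ (begin
    ∣ B ∣ + Δ G  ≡⟨ +-comm ∣ B ∣ (Δ G) ⟩
    Δ G + ∣ B ∣  ≤⟨ m≤o∸n⇒m+n≤o (Δ G) (m≤n⇒m≤n+o k (∣p∣≤n B)) Δ≤n+k∸∣B∣ ⟩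
    n + k        ∎)
    where
    open ≤-Reasoning
    Δ≤n+k∸∣B∣ : Δ G ≤ (n + k) ∸ ∣ B ∣
    Δ≤n+k∸∣B∣ = Δ-lub G λ v → m+n≤o⇒m≤o∸n (deg G v) (packing-deg+∣B∣≤n+k v)

mainTheorem2 : (k : ℕ) → 1 ≤ k → (n : ℕ) → (G : Graph n) → L k G ≤ (n + k) ∸ Δ G
mainTheorem2 k _ n G = foldr-⊔-map-lub _ candidate≤ (allSubsets n)
  where
  candidate≤ : ∀ B → (if does (isKTLP? k G B) then ∣ B ∣ else 0) ≤ (n + k) ∸ Δ G
  candidate≤ B = if-does-≤ (isKTLP? k G B) (packing-∣B∣≤n+k∸Δ k G B)
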